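{- Let $k\ge1$ and $\ell$ be integers, let $G=(V,E)$ be a $(k,\ell)$-sparse hypergraph of dimension $s$ with $0\le\ell\le sk-1$, and let $C_1\neq C_2$ be components of $G$. Then $E(C_1)$ and $E(C_2)$ are disjoint and $|V(C_1)\cap V(C_2)|<s$. If moreover $\ell\le k$, then $C_1$ and $C_2$ are vertex disjoint. If $\ell=0$, then $G$ has only one component.
   Context: A hypergraph $G=(V,E)$ consists of a finite vertex set $V$ and a finite multiset $E$ of nonempty subsets of $V$ (edges; parallel copies allowed, an edge of size one is a loop). The dimension of an edge $e$ is $|e|$, and the dimension of $G$ is the minimum dimension of its edges. For $V'\subseteq V$, $E(V')$ denotes the multiset of edges of $G$ contained in $V'$. For integers $k\ge1$ and $\ell$, a hypergraph is $(k,\ell)$-sparse if $|E(V')|\le k|V'|-\ell$ for every $V'\subseteq V$ with $E(V')$ nonempty, and $(k,\ell)$-tight if it is $(k,\ell)$-sparse and has exactly $k|V|-\ell$ edges. A block of a $(k,\ell)$-sparse hypergraph $G$ is a subgraph $B=(V(B),E(B))$ of $G$ ($V(B)\subseteq V$, $E(B)\subseteq E$, each edge of $E(B)$ contained in $V(B)$) that is $(k,\ell)$-tight. A component of $G$ is a block that is maximal under inclusion among blocks of $G$. -}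

module Defs where

open import Data.Nat as ℕ using (ℕ)
open import Data.Integer as ℤ using (ℤ; +_; _-_)
open import Data.Fin using (Fin)
open import Data.Fin.Subset using (Subset; _⊆_; _∩_; ∣_∣; Nonempty)
open import Data.Fin.Subset.Properties using (_⊆?_)
open import Data.Vec using (tabulate)
open import Data.Bool using (Bool)
open import Data.Product using (_×_; Σ)
open import Relation.Binary.PropositionalEquality using (_≡_)
open import Relation.Nullary using (does)

-- A hypergraph on the vertex set Fin n with m edges, given as an indexed
-- family (so parallel copies are allowed); every edge is a nonempty subset.
record Hypergraph : Set where
  field
    n        : ℕ
    m        : ℕ
    edge     : Fin m → Subset n
    nonempty : (i : Fin m) → Nonempty (edge i)

module _ (G : Hypergraph) where
  open Hypergraph G

  edgesIn : Subset n → Subset m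
  edgesIn V' = tabulate (λ i → does (edge i ⊆? V'))

  HasDimension : ℕ → Set
  HasDimension s = Σ (Fin m) (λ i → ∣ edge i ∣ ≡ s) × ((i : Fin m) → s ℕ.≤ ∣ edge i ∣)

  SparseSub : ℕ → ℤ → Subset n → Subset m → Set
  SparseSub k ℓ W F = (V' : Subset n) → V' ⊆ W → Nonempty (F ∩ edgesIn V') →
    + ∣ F ∩ edgesIn V' ∣ ℤ.≤ + (k ℕ.* ∣ V' ∣) - ℓ

  TightSub : ℕ → ℤ → Subset n → Subset m → Set
  TightSub k ℓ W F = SparseSub k ℓ W F × (+ ∣ F ∣ ≡ + (k ℕ.* ∣ W ∣) - ℓ)

  Sparse : ℕ → ℤ → Set
  Sparse k ℓ = SparseSub k ℓ Data.Fin.Subset.⊤ Data.Fin.Subset.⊤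

  Block : ℕ → ℤ → Subset n → Subset m → Set
  Block k ℓ W F = F ⊆ edgesIn W × TightSub k ℓ W F

  Component : ℕ → ℤ → Subset n → Subset m → Set
  Component k ℓ W F = Block k ℓ W F ×
    ((W' : Subset n) (F' : Subset m) → Block k ℓ W' F' → W ⊆ W' → F ⊆ F' →
      (W ≡ W') × (F ≡ F'))

-- Two blocks (W₁, F₁), (W₂, F₂) always satisfy the modular count
--   (|F₁ ∪ F₂| + ℓ) + (|F₁ ∩ F₂| + ℓ) = k |W₁ ∪ W₂| + k |W₁ ∩ W₂|,
-- and sparsity bounds the first summand by k |W₁ ∪ W₂|.  So whenever
-- |F₁ ∩ F₂| + ℓ ≤ k |W₁ ∩ W₂| the union is again a block, and two such
-- components coincide by maximality.  For distinct components this must fail;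
-- sparsity makes it hold as soon as F₁ ∩ F₂ ≠ ∅, so the edge sets are disjoint
-- and k |W₁ ∩ W₂| < ℓ, which gives |W₁ ∩ W₂| < s when ℓ < sk, and W₁ ∩ W₂ = ∅
-- when ℓ ≤ k.  For ℓ = 0 this is impossible, so components are unique; and
-- since every block is induced (F = E(W)), a tight vertex set of maximum size
-- (∅ is tight, as edges are nonempty) spans a component.
module Submission where

open import Defs
open import Data.Nat as ℕ using (ℕ)
open import Data.Integer as ℤ using (ℤ; +_; _-_)
open import Data.Fin.Subset using (Subset; _∩_; ∣_∣; Empty)
open import Data.Product using (_×_; Σ)
open import Relation.Binary.PropositionalEquality using (_≡_)
open import Relation.Nullary using (¬_)

import Data.Integer.Properties as ℤP
open import Algebra.Properties.AbelianGroup ℤP.+-0-abelianGroup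
  using (//-rightDividesˡ; //-rightDividesʳ)
open import Data.Fin.Subset using (_∪_; _⊆_; _∈_; Nonempty; ⊥; inside; outside)
open import Data.Fin.Subset.Properties
open import Data.Nat using (zero; suc; _*_; _≤_; _<_; z≤n; s≤s)
import Data.Nat.Properties as ℕP
open import Algebra.Properties.CommutativeSemigroup ℕP.+-commutativeSemigroup using (interchange)
open import Data.Product using (∃; _,_; proj₁; proj₂)
open import Data.Sum using (inj₁; inj₂)
open import Data.Vec using ([]; _∷_; here)
open import Data.Bool.Properties using (_≟_)
open import Data.Vec.Properties using (≡-dec; lookup∘tabulate; []=⇒lookup; lookup⇒[]=)
open import Relation.Binary.PropositionalEquality
  using (refl; sym; trans; cong; cong₂; subst; subst₂; module ≡-Reasoning)
open import Relation.Nullary using (yes; no; does; contradiction)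
open import Relation.Nullary.Decidable using (_×-dec_; dec-true)
open import Relation.Unary using (Pred; Decidable)

+a≤+b-+c⇒a+c≤b : ∀ {a b c} → + a ℤ.≤ + b - + c → a ℕ.+ c ≤ b
+a≤+b-+c⇒a+c≤b {a} {b} {c} h = ℤP.drop‿+≤+ (begin
  + (a ℕ.+ c)       ≡⟨ ℤP.pos-+ a c ⟩
  + a ℤ.+ + c       ≤⟨ ℤP.+-monoˡ-≤ (+ c) h ⟩
  + b - + c ℤ.+ + c ≡⟨ //-rightDividesˡ (+ c) (+ b) ⟩
  + b               ∎)
  where open ℤP.≤-Reasoning

a+c≤b⇒+a≤+b-+c : ∀ {a b c} → a ℕ.+ c ≤ b → + a ℤ.≤ + b - + c
a+c≤b⇒+a≤+b-+c {a} {b} {c} h = begin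
  + a               ≡⟨ //-rightDividesʳ (+ c) (+ a) ⟨
  + a ℤ.+ + c - + c ≡⟨ cong (_- + c) (ℤP.pos-+ a c) ⟨
  + (a ℕ.+ c) - + c ≤⟨ ℤP.+-monoˡ-≤ (ℤ.- + c) (ℤ.+≤+ h) ⟩
  + b - + c         ∎
  where open ℤP.≤-Reasoning

+a≡+b-+c⇒a+c≡b : ∀ {a b c} → + a ≡ + b - + c → a ℕ.+ c ≡ b
+a≡+b-+c⇒a+c≡b {a} {b} {c} h = ℤP.+-injective (begin
  + (a ℕ.+ c)       ≡⟨ ℤP.pos-+ a c ⟩
  + a ℤ.+ + c       ≡⟨ cong (ℤ._+ + c) h ⟩
  + b - + c ℤ.+ + c ≡⟨ //-rightDividesˡ (+ c) (+ b) ⟩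
  + b               ∎)
  where open ≡-Reasoning

a+c≡b⇒+a≡+b-+c : ∀ {a b c} → a ℕ.+ c ≡ b → + a ≡ + b - + c
a+c≡b⇒+a≡+b-+c {a} {c = c} refl = begin
  + a               ≡⟨ //-rightDividesʳ (+ c) (+ a) ⟨
  + a ℤ.+ + c - + c ≡⟨ cong (_- + c) (ℤP.pos-+ a c) ⟨
  + (a ℕ.+ c) - + c ∎
  where open ≡-Reasoning

∣p∪q∣+∣p∩q∣≡∣p∣+∣q∣ : ∀ {n} (p q : Subset n) → ∣ p ∪ q ∣ ℕ.+ ∣ p ∩ q ∣ ≡ ∣ p ∣ ℕ.+ ∣ q ∣
∣p∪q∣+∣p∩q∣≡∣p∣+∣q∣ []            []            = refl
∣p∪q∣+∣p∩q∣≡∣p∣+∣q∣ (outside ∷ p) (outside ∷ q) = ∣p∪q∣+∣p∩q∣≡∣p∣+∣q∣ p q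
∣p∪q∣+∣p∩q∣≡∣p∣+∣q∣ (inside ∷ p)  (outside ∷ q) = cong suc (∣p∪q∣+∣p∩q∣≡∣p∣+∣q∣ p q)
∣p∪q∣+∣p∩q∣≡∣p∣+∣q∣ (outside ∷ p) (inside ∷ q)  =
  trans (cong suc (∣p∪q∣+∣p∩q∣≡∣p∣+∣q∣ p q)) (sym (ℕP.+-suc ∣ p ∣ ∣ q ∣))
∣p∪q∣+∣p∩q∣≡∣p∣+∣q∣ (inside ∷ p)  (inside ∷ q)  = cong suc (begin
  ∣ p ∪ q ∣ ℕ.+ suc ∣ p ∩ q ∣   ≡⟨ ℕP.+-suc ∣ p ∪ q ∣ ∣ p ∩ q ∣ ⟩
  suc (∣ p ∪ q ∣ ℕ.+ ∣ p ∩ q ∣) ≡⟨ cong suc (∣p∪q∣+∣p∩q∣≡∣p∣+∣q∣ p q) ⟩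
  suc (∣ p ∣ ℕ.+ ∣ q ∣)         ≡⟨ ℕP.+-suc ∣ p ∣ ∣ q ∣ ⟨
  ∣ p ∣ ℕ.+ suc ∣ q ∣           ∎)
  where open ≡-Reasoning

p⊆q∧∣q∣≤∣p∣⇒p≡q : ∀ {n} {p q : Subset n} → p ⊆ q → ∣ q ∣ ≤ ∣ p ∣ → p ≡ q
p⊆q∧∣q∣≤∣p∣⇒p≡q {p = []}          {[]}          _   _       = refl
p⊆q∧∣q∣≤∣p∣⇒p≡q {p = outside ∷ p} {outside ∷ q} p⊆q ∣q∣≤∣p∣ =
  cong (outside ∷_) (p⊆q∧∣q∣≤∣p∣⇒p≡q (drop-∷-⊆ p⊆q) ∣q∣≤∣p∣)
p⊆q∧∣q∣≤∣p∣⇒p≡q {p = outside ∷ p} {inside ∷ q}  p⊆q ∣q∣≤∣p∣ =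
  contradiction (ℕP.≤-trans ∣q∣≤∣p∣ (p⊆q⇒∣p∣≤∣q∣ (drop-∷-⊆ p⊆q))) (ℕP.n≮n ∣ q ∣)
p⊆q∧∣q∣≤∣p∣⇒p≡q {p = inside ∷ p}  {outside ∷ q} p⊆q _ with () ← p⊆q here
p⊆q∧∣q∣≤∣p∣⇒p≡q {p = inside ∷ p}  {inside ∷ q}  p⊆q (s≤s ∣q∣≤∣p∣) =
  cong (inside ∷_) (p⊆q∧∣q∣≤∣p∣⇒p≡q (drop-∷-⊆ p⊆q) ∣q∣≤∣p∣)

Empty⇒∣p∣≡0 : ∀ {n} {p : Subset n} → Empty p → ∣ p ∣ ≡ 0
Empty⇒∣p∣≡0 {n} p-empty = trans (cong ∣_∣ (Empty-unique p-empty)) (∣⊥∣≡0 n)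

Nonempty⇒0<∣p∣ : ∀ {n} {p : Subset n} → Nonempty p → 0 < ∣ p ∣
Nonempty⇒0<∣p∣ (x , x∈p) = ℕP.≤-<-trans z≤n (x∈p⇒∣p-x∣<∣p∣ x∈p)

-- The fuel bounds n ∸ ∣ p ∣, which drops with every strictly larger witness.
∃-largest : ∀ {n a} {P : Pred (Subset n) a} → Decidable P → ∀ {p} → P p →
  ∃ λ q → P q × (∀ r → P r → ∣ r ∣ ≤ ∣ q ∣)
∃-largest {n} {P = P} P? {p} Pp = search n (ℕP.m≤m+n n ∣ p ∣) Pp
  where
  search : ∀ slack {p} → n ≤ slack ℕ.+ ∣ p ∣ → P p → ∃ λ q → P q × (∀ r → P r → ∣ r ∣ ≤ ∣ q ∣)
  search slack {p} n≤slack+∣p∣ Pp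
    with anySubset? (λ r → P? r ×-dec ∣ p ∣ ℕ.<? ∣ r ∣)
  ... | no ∄larger = p , Pp , λ r Pr → ℕP.≮⇒≥ (λ ∣p∣<∣r∣ → ∄larger (r , Pr , ∣p∣<∣r∣))
  search zero        n≤∣p∣ _ | yes (r , _ , ∣p∣<∣r∣) =
    contradiction (ℕP.<-≤-trans ∣p∣<∣r∣ (ℕP.≤-trans (∣p∣≤n r) n≤∣p∣)) (ℕP.n≮n _)
  search (suc slack) {p} n≤slack+∣p∣ _ | yes (r , Pr , ∣p∣<∣r∣) =
    search slack (ℕP.≤-trans n≤slack+∣p∣
      (ℕP.≤-trans (ℕP.≤-reflexive (sym (ℕP.+-suc slack ∣ p ∣))) (ℕP.+-monoʳ-≤ slack ∣p∣<∣r∣))) Pr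

module _ (G : Hypergraph) where
  open Hypergraph G

  ∈-edgesIn⁻ : ∀ {V i} → i ∈ edgesIn G V → edge i ⊆ V
  ∈-edgesIn⁻ {V} {i} i∈E
    with edge i ⊆? V | trans (sym (lookup∘tabulate (λ j → does (edge j ⊆? V)) i)) ([]=⇒lookup i∈E)
  ... | yes edge⊆V | _ = edge⊆V
  ... | no _       | ()

  ∈-edgesIn⁺ : ∀ {V i} → edge i ⊆ V → i ∈ edgesIn G V
  ∈-edgesIn⁺ {V} {i} edge⊆V = lookup⇒[]= i (edgesIn G V)
    (trans (lookup∘tabulate (λ j → does (edge j ⊆? V)) i) (dec-true (edge i ⊆? V) edge⊆V))

  edgesIn-mono : ∀ {V W} → V ⊆ W → edgesIn G V ⊆ edgesIn G W
  edgesIn-mono V⊆W i∈E = ∈-edgesIn⁺ (λ x∈edge → V⊆W (∈-edgesIn⁻ i∈E x∈edge))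

  ⊆edgesIn-∪ : ∀ {W₁ W₂ F₁ F₂} → F₁ ⊆ edgesIn G W₁ → F₂ ⊆ edgesIn G W₂ →
    F₁ ∪ F₂ ⊆ edgesIn G (W₁ ∪ W₂)
  ⊆edgesIn-∪ {W₁} {W₂} {F₁} {F₂} F₁⊆ F₂⊆ i∈F₁∪F₂ with x∈p∪q⁻ F₁ F₂ i∈F₁∪F₂
  ... | inj₁ i∈F₁ = edgesIn-mono (p⊆p∪q W₂) (F₁⊆ i∈F₁)
  ... | inj₂ i∈F₂ = edgesIn-mono (q⊆p∪q W₁ W₂) (F₂⊆ i∈F₂)

  ⊆edgesIn-∩ : ∀ {W₁ W₂ F₁ F₂} → F₁ ⊆ edgesIn G W₁ → F₂ ⊆ edgesIn G W₂ →
    F₁ ∩ F₂ ⊆ edgesIn G (W₁ ∩ W₂)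
  ⊆edgesIn-∩ {F₁ = F₁} {F₂} F₁⊆ F₂⊆ i∈F₁∩F₂ =
    let i∈F₁ , i∈F₂ = x∈p∩q⁻ F₁ F₂ i∈F₁∩F₂
    in ∈-edgesIn⁺ (λ x∈edge → x∈p∩q⁺ (∈-edgesIn⁻ (F₁⊆ i∈F₁) x∈edge , ∈-edgesIn⁻ (F₂⊆ i∈F₂) x∈edge))

  edgesIn-⊥-empty : Empty (edgesIn G ⊥)
  edgesIn-⊥-empty (i , i∈E) = let x , x∈edge = nonempty i in ∉⊥ (∈-edgesIn⁻ i∈E x∈edge)

module _ (G : Hypergraph) (k ℓ : ℕ) (sparse : Sparse G k (+ ℓ)) where
  open Hypergraph G

  ∣F∣+ℓ≤k∣W∣ : ∀ {W F} → F ⊆ edgesIn G W → Nonempty F → ∣ F ∣ ℕ.+ ℓ ≤ k * ∣ W ∣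
  ∣F∣+ℓ≤k∣W∣ {W} {F} F⊆E (i , i∈F) =
    ℕP.≤-trans (ℕP.+-monoˡ-≤ ℓ (p⊆q⇒∣p∣≤∣q∣ F⊆E)) (+a≤+b-+c⇒a+c≤b ∣E∣-bound)
    where
    ∣E∣-bound : + ∣ edgesIn G W ∣ ℤ.≤ + (k * ∣ W ∣) - + ℓ
    ∣E∣-bound = subst (λ E → + ∣ E ∣ ℤ.≤ + (k * ∣ W ∣) - + ℓ) (∩-identityˡ (edgesIn G W))
      (sparse W ⊆⊤ (i , x∈p∩q⁺ (∈⊤ , F⊆E i∈F)))

  block-count : ∀ {W F} → Block G k (+ ℓ) W F → ∣ F ∣ ℕ.+ ℓ ≡ k * ∣ W ∣
  block-count (_ , _ , count) = +a≡+b-+c⇒a+c≡b count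

  tight-subgraph⇒block : ∀ {W F} → F ⊆ edgesIn G W → ∣ F ∣ ℕ.+ ℓ ≡ k * ∣ W ∣ →
    Block G k (+ ℓ) W F
  tight-subgraph⇒block {W} {F} F⊆E count = F⊆E , subgraph-sparse , a+c≡b⇒+a≡+b-+c count
    where
    subgraph-sparse : SparseSub G k (+ ℓ) W F
    subgraph-sparse V _ F∩E-nonempty =
      a+c≤b⇒+a≤+b-+c (∣F∣+ℓ≤k∣W∣ (p∩q⊆q F (edgesIn G V)) F∩E-nonempty)

  ∣F∣+ℓ≤k∣W∣-above-block : ∀ {W₀ F₀ W F} → Block G k (+ ℓ) W₀ F₀ → W₀ ⊆ W →
    F ⊆ edgesIn G W → ∣ F ∣ ℕ.+ ℓ ≤ k * ∣ W ∣
  ∣F∣+ℓ≤k∣W∣-above-block {W₀} {F₀} {W} {F} b₀ W₀⊆W F⊆E with nonempty? F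
  ... | yes F-nonempty = ∣F∣+ℓ≤k∣W∣ F⊆E F-nonempty
  ... | no F-empty = begin
    ∣ F ∣ ℕ.+ ℓ   ≡⟨ cong (ℕ._+ ℓ) (Empty⇒∣p∣≡0 F-empty) ⟩
    ℓ             ≤⟨ ℕP.m≤n+m ℓ ∣ F₀ ∣ ⟩
    ∣ F₀ ∣ ℕ.+ ℓ  ≡⟨ block-count b₀ ⟩
    k * ∣ W₀ ∣    ≤⟨ ℕP.*-monoʳ-≤ k (p⊆q⇒∣p∣≤∣q∣ W₀⊆W) ⟩
    k * ∣ W ∣     ∎
    where open ℕP.≤-Reasoning

  block-count-modular : ∀ {W₁ W₂ F₁ F₂} → Block G k (+ ℓ) W₁ F₁ → Block G k (+ ℓ) W₂ F₂ →
    (∣ F₁ ∪ F₂ ∣ ℕ.+ ℓ) ℕ.+ (∣ F₁ ∩ F₂ ∣ ℕ.+ ℓ) ≡ k * ∣ W₁ ∪ W₂ ∣ ℕ.+ k * ∣ W₁ ∩ W₂ ∣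
  block-count-modular {W₁} {W₂} {F₁} {F₂} b₁ b₂ = begin
    (∣ F₁ ∪ F₂ ∣ ℕ.+ ℓ) ℕ.+ (∣ F₁ ∩ F₂ ∣ ℕ.+ ℓ) ≡⟨ interchange (∣ F₁ ∪ F₂ ∣) ℓ (∣ F₁ ∩ F₂ ∣) ℓ ⟩
    (∣ F₁ ∪ F₂ ∣ ℕ.+ ∣ F₁ ∩ F₂ ∣) ℕ.+ (ℓ ℕ.+ ℓ) ≡⟨ cong (ℕ._+ (ℓ ℕ.+ ℓ)) (∣p∪q∣+∣p∩q∣≡∣p∣+∣q∣ F₁ F₂) ⟩
    (∣ F₁ ∣ ℕ.+ ∣ F₂ ∣) ℕ.+ (ℓ ℕ.+ ℓ)           ≡⟨ interchange (∣ F₁ ∣) (∣ F₂ ∣) ℓ ℓ ⟩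
    (∣ F₁ ∣ ℕ.+ ℓ) ℕ.+ (∣ F₂ ∣ ℕ.+ ℓ)           ≡⟨ cong₂ ℕ._+_ (block-count b₁) (block-count b₂) ⟩
    k * ∣ W₁ ∣ ℕ.+ k * ∣ W₂ ∣                   ≡⟨ ℕP.*-distribˡ-+ k _ _ ⟨
    k * (∣ W₁ ∣ ℕ.+ ∣ W₂ ∣)                     ≡⟨ cong (k *_) (∣p∪q∣+∣p∩q∣≡∣p∣+∣q∣ W₁ W₂) ⟨
    k * (∣ W₁ ∪ W₂ ∣ ℕ.+ ∣ W₁ ∩ W₂ ∣)           ≡⟨ ℕP.*-distribˡ-+ k _ _ ⟩
    k * ∣ W₁ ∪ W₂ ∣ ℕ.+ k * ∣ W₁ ∩ W₂ ∣         ∎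
    where open ≡-Reasoning

  block-∪ : ∀ {W₁ W₂ F₁ F₂} → Block G k (+ ℓ) W₁ F₁ → Block G k (+ ℓ) W₂ F₂ →
    ∣ F₁ ∩ F₂ ∣ ℕ.+ ℓ ≤ k * ∣ W₁ ∩ W₂ ∣ → Block G k (+ ℓ) (W₁ ∪ W₂) (F₁ ∪ F₂)
  block-∪ {W₁} {W₂} {F₁} {F₂} b₁ b₂ ∩-bound =
    tight-subgraph⇒block F₁∪F₂⊆E (ℕP.≤-antisym ∪-upper ∪-lower)
    where
    F₁∪F₂⊆E : F₁ ∪ F₂ ⊆ edgesIn G (W₁ ∪ W₂)
    F₁∪F₂⊆E = ⊆edgesIn-∪ G (proj₁ b₁) (proj₁ b₂)
    ∪-upper : ∣ F₁ ∪ F₂ ∣ ℕ.+ ℓ ≤ k * ∣ W₁ ∪ W₂ ∣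
    ∪-upper = ∣F∣+ℓ≤k∣W∣-above-block b₁ (p⊆p∪q W₂) F₁∪F₂⊆E
    ∪-lower : k * ∣ W₁ ∪ W₂ ∣ ≤ ∣ F₁ ∪ F₂ ∣ ℕ.+ ℓ
    ∪-lower = ℕP.+-cancelʳ-≤ (∣ F₁ ∩ F₂ ∣ ℕ.+ ℓ) _ _ (begin
      k * ∣ W₁ ∪ W₂ ∣ ℕ.+ (∣ F₁ ∩ F₂ ∣ ℕ.+ ℓ)     ≤⟨ ℕP.+-monoʳ-≤ (k * ∣ W₁ ∪ W₂ ∣) ∩-bound ⟩
      k * ∣ W₁ ∪ W₂ ∣ ℕ.+ k * ∣ W₁ ∩ W₂ ∣         ≡⟨ block-count-modular b₁ b₂ ⟨
      (∣ F₁ ∪ F₂ ∣ ℕ.+ ℓ) ℕ.+ (∣ F₁ ∩ F₂ ∣ ℕ.+ ℓ) ∎)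
      where open ℕP.≤-Reasoning

  components-≡ : ∀ {W₁ W₂ F₁ F₂} → Component G k (+ ℓ) W₁ F₁ → Component G k (+ ℓ) W₂ F₂ →
    ∣ F₁ ∩ F₂ ∣ ℕ.+ ℓ ≤ k * ∣ W₁ ∩ W₂ ∣ → (W₁ ≡ W₂) × (F₁ ≡ F₂)
  components-≡ {W₁} {W₂} {F₁} {F₂} (b₁ , maximal₁) (b₂ , maximal₂) ∩-bound =
    let b∪ = block-∪ b₁ b₂ ∩-bound
        W₁≡W∪ , F₁≡F∪ = maximal₁ _ _ b∪ (p⊆p∪q W₂) (p⊆p∪q F₂)
        W₂≡W∪ , F₂≡F∪ = maximal₂ _ _ b∪ (q⊆p∪q W₁ W₂) (q⊆p∪q F₁ F₂)
    in trans W₁≡W∪ (sym W₂≡W∪) , trans F₁≡F∪ (sym F₂≡F∪)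

  distinct-components : ∀ {W₁ W₂ F₁ F₂} →
    Component G k (+ ℓ) W₁ F₁ → Component G k (+ ℓ) W₂ F₂ → ¬ ((W₁ ≡ W₂) × (F₁ ≡ F₂)) →
    Empty (F₁ ∩ F₂) × k * ∣ W₁ ∩ W₂ ∣ < ℓ
  distinct-components {W₁} {W₂} {F₁} {F₂} c₁ c₂ c₁≢c₂ = F₁∩F₂-empty , ℕP.≰⇒> ℓ≰k∣W₁∩W₂∣
    where
    F₁∩F₂-empty : Empty (F₁ ∩ F₂)
    F₁∩F₂-empty F₁∩F₂-nonempty = c₁≢c₂ (components-≡ c₁ c₂
      (∣F∣+ℓ≤k∣W∣ (⊆edgesIn-∩ G (proj₁ (proj₁ c₁)) (proj₁ (proj₁ c₂))) F₁∩F₂-nonempty))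
    ℓ≰k∣W₁∩W₂∣ : ¬ ℓ ≤ k * ∣ W₁ ∩ W₂ ∣
    ℓ≰k∣W₁∩W₂∣ ℓ≤ = c₁≢c₂ (components-≡ c₁ c₂
      (subst (λ f → f ℕ.+ ℓ ≤ k * ∣ W₁ ∩ W₂ ∣) (sym (Empty⇒∣p∣≡0 F₁∩F₂-empty)) ℓ≤))

  block⇒induced : ∀ {W F} → Block G k (+ ℓ) W F → F ≡ edgesIn G W
  block⇒induced {W} {F} b = p⊆q∧∣q∣≤∣p∣⇒p≡q (proj₁ b) (ℕP.+-cancelʳ-≤ ℓ _ _ (begin
    ∣ edgesIn G W ∣ ℕ.+ ℓ ≤⟨ ∣F∣+ℓ≤k∣W∣-above-block b ⊆-refl ⊆-refl ⟩
    k * ∣ W ∣             ≡⟨ block-count b ⟨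
    ∣ F ∣ ℕ.+ ℓ           ∎))
    where open ℕP.≤-Reasoning

  Tight : Subset n → Set
  Tight W = ∣ edgesIn G W ∣ ℕ.+ ℓ ≡ k * ∣ W ∣

  tight? : Decidable Tight
  tight? W = ∣ edgesIn G W ∣ ℕ.+ ℓ ℕ.≟ k * ∣ W ∣

  block⇒tight : ∀ {W F} → Block G k (+ ℓ) W F → Tight W
  block⇒tight {W} b = subst (λ F → ∣ F ∣ ℕ.+ ℓ ≡ k * ∣ W ∣) (block⇒induced b) (block-count b)

  largest-tight⇒component : ∀ {W} → Tight W → (∀ W′ → Tight W′ → ∣ W′ ∣ ≤ ∣ W ∣) →
    Component G k (+ ℓ) W (edgesIn G W)
  largest-tight⇒component {W} W-tight W-largest = tight-subgraph⇒block ⊆-refl W-tight , maximal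
    where
    maximal : ∀ W′ F′ → Block G k (+ ℓ) W′ F′ → W ⊆ W′ → edgesIn G W ⊆ F′ →
      (W ≡ W′) × (edgesIn G W ≡ F′)
    maximal W′ F′ b′ W⊆W′ _ = W≡W′ , trans (cong (edgesIn G) W≡W′) (sym (block⇒induced b′))
      where
      W≡W′ : W ≡ W′
      W≡W′ = p⊆q∧∣q∣≤∣p∣⇒p≡q W⊆W′ (W-largest W′ (block⇒tight b′))

  ∅-tight : ℓ ≡ 0 → Tight ⊥
  ∅-tight refl = begin
    ∣ edgesIn G ⊥ ∣ ℕ.+ 0 ≡⟨ ℕP.+-identityʳ _ ⟩
    ∣ edgesIn G ⊥ ∣       ≡⟨ Empty⇒∣p∣≡0 (edgesIn-⊥-empty G) ⟩
    0                     ≡⟨ ℕP.*-zeroʳ k ⟨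
    k * 0                 ≡⟨ cong (k *_) (∣⊥∣≡0 n) ⟨
    k * ∣ ⊥ {n} ∣         ∎
    where open ≡-Reasoning

  component-exists : ℓ ≡ 0 → ∃ λ W → ∃ λ F → Component G k (+ ℓ) W F
  component-exists ℓ≡0 =
    let W , W-tight , W-largest = ∃-largest tight? (∅-tight ℓ≡0)
    in W , edgesIn G W , largest-tight⇒component W-tight W-largest

  components-unique : ℓ ≡ 0 → ∀ {W₁ W₂ F₁ F₂} →
    Component G k (+ ℓ) W₁ F₁ → Component G k (+ ℓ) W₂ F₂ → (W₁ ≡ W₂) × (F₁ ≡ F₂)
  components-unique refl {W₁} {W₂} {F₁} {F₂} c₁ c₂ with ≡-dec _≟_ W₁ W₂ ×-dec ≡-dec _≟_ F₁ F₂
  ... | yes c₁≡c₂ = c₁≡c₂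
  ... | no c₁≢c₂ = contradiction (proj₂ (distinct-components c₁ c₂ c₁≢c₂)) ℕP.n≮0

mainTheorem2 : (G : Hypergraph) (k : ℕ) (ℓ : ℤ) (s : ℕ) →
    1 ℕ.≤ k → HasDimension G s → + 0 ℤ.≤ ℓ → ℓ ℤ.≤ + (s ℕ.* k) - + 1 →
    Sparse G k ℓ →
    ((W₁ W₂ : Subset (Hypergraph.n G)) (F₁ F₂ : Subset (Hypergraph.m G)) →
      Component G k ℓ W₁ F₁ → Component G k ℓ W₂ F₂ →
      ¬ ((W₁ ≡ W₂) × (F₁ ≡ F₂)) →
      Empty (F₁ ∩ F₂) × (∣ W₁ ∩ W₂ ∣ ℕ.< s) × (ℓ ℤ.≤ + k → Empty (W₁ ∩ W₂)))
    × (ℓ ≡ + 0 →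
      Σ (Subset (Hypergraph.n G)) (λ W → Σ (Subset (Hypergraph.m G)) (λ F →
        Component G k ℓ W F ×
        ((W' : Subset (Hypergraph.n G)) (F' : Subset (Hypergraph.m G)) →
          Component G k ℓ W' F' → (W' ≡ W) × (F' ≡ F)))))
mainTheorem2 G k (+ ℓ) s _ _ _ ℓ≤sk-1 sparse =
  (λ _ _ _ _ c₁ c₂ c₁≢c₂ →
    let F₁∩F₂-empty , k∣W₁∩W₂∣<ℓ = distinct-components G k ℓ sparse c₁ c₂ c₁≢c₂
    in F₁∩F₂-empty , overlap<s k∣W₁∩W₂∣<ℓ , λ ℓ≤k → overlap-empty k∣W₁∩W₂∣<ℓ (ℤP.drop‿+≤+ ℓ≤k)) ,
  λ { refl → let W , F , c = component-exists G k 0 sparse refl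
             in W , F , c , λ _ _ c′ → components-unique G k 0 sparse refl c′ c }
  where
  ℓ<k*s : ℓ < k * s
  ℓ<k*s = subst₂ _≤_ (ℕP.+-comm ℓ 1) (ℕP.*-comm s k) (+a≤+b-+c⇒a+c≤b ℓ≤sk-1)

  overlap<s : ∀ {w} → k * w < ℓ → w < s
  overlap<s k*w<ℓ = ℕP.*-cancelˡ-< k _ _ (ℕP.<-trans k*w<ℓ ℓ<k*s)

  overlap-empty : ∀ {N} {W : Subset N} → k * ∣ W ∣ < ℓ → ℓ ≤ k → Empty W
  overlap-empty {W = W} k∣W∣<ℓ ℓ≤k W-nonempty = ℕP.<⇒≱ k∣W∣<ℓ (begin
    ℓ          ≤⟨ ℓ≤k ⟩
    k          ≡⟨ ℕP.*-identityʳ k ⟨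
    k * 1      ≤⟨ ℕP.*-monoʳ-≤ k (Nonempty⇒0<∣p∣ W-nonempty) ⟩
    k * ∣ W ∣  ∎)
    where open ℕP.≤-Reasoning
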